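{- Let $q\in\mathbb{C}$ with $|q|<1$, and let $k,l\ge0$ be integers. Then for $x\in[0,1]$, $$B_{k,l}(x,q)=\frac{x^k}{[k]_q!}\sum_{m=0}^l\frac{[m]_q!}{m!}\binom{l}{m}_q\,\beta_{l-m}^{(k)}((1-x)_q,q)\,\Delta^k0^m,\qquad\text{where }\Delta^k0^m=\sum_{j=0}^k\binom{k}{j}(-1)^{k-j}j^m.$$
   Context: $[x]_q=\frac{1-q^x}{1-q}$, $[n]_q!=[n]_q\cdots[1]_q$, $[0]_q!=1$, $\binom{n}{k}_q=\frac{[n]_q!}{[k]_q![n-k]_q!}$ for $0\le k\le n$; $0^0=1$. $(1-x)_q^m=\prod_{i=1}^m(1-xq^{i-1})$. $B_{k,n}(x,q)=\binom{n}{k}_qx^k(1-x)_q^{n-k}$ if $n\ge k$ and $0$ if $n<k$. $B_m^{(k)}$ are the Bernoulli numbers of order $k$: $\left(\frac{z}{e^z-1}\right)^k=\sum_{m\ge0}B_m^{(k)}\frac{z^m}{m!}$. $\beta_n^{(k)}((1-x)_q,q)=\sum_{m=0}^n\binom{n}{m}_q\frac{[m]_q!}{m!}(1-x)_q^{n-m}B_m^{(k)}$ (the $q$-Bernoulli polynomial of order $k$, defined by $\left(\frac{z}{e^z-1}\right)^ke_q(zy)=\sum_n\beta_n^{(k)}(y,q)\frac{z^n}{[n]_q!}$ with $e_q(u)=\sum_j u^j/[j]_q!$, with powers $y^j$ replaced by $(1-x)_q^j$). -}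

module Defs where

open import Level using (Level)
open import Data.Nat as ℕ using (ℕ; zero; suc; _!; _≟_)
open import Data.Nat.Properties using (_!≢0)
open import Data.Nat.Combinatorics using (_C_)
open import Data.Integer as ℤ using (ℤ; +_)
open import Data.Rational as ℚ using (ℚ; _/_)
open import Relation.Nullary using (yes; no)
open import Algebra.Bundles using (CommutativeRing)

Σℚ : ℕ → (ℕ → ℚ) → ℚ
Σℚ zero    f = f 0
Σℚ (suc n) f = Σℚ n f ℚ.+ f (suc n)

ℕtoℚ : ℕ → ℚ
ℕtoℚ n = (+ n) / 1

-- bernTab n i = B_i (ordinary Bernoulli numbers, B_1 = -1/2) for i ≤ n,
-- via B_0 = 1 and  Σ_{j=0}^{m} C(m+1,j) B_j = 0  (m ≥ 1), which is the
-- coefficient form of  (z/(e^z-1)) (e^z-1)/z = 1.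
bernTab : ℕ → ℕ → ℚ
bernTab zero    i = ℚ.1ℚ
bernTab (suc n) i with i ≟ suc n
... | yes _ = ℚ.- ((+ 1 / (suc (suc n))) ℚ.*
                   Σℚ n (λ j → ℕtoℚ (suc (suc n) C j) ℚ.* bernTab n j))
... | no  _ = bernTab n i

bern1 : ℕ → ℚ
bern1 m = bernTab m m

-- Bernoulli numbers of order k: (z/(e^z-1))^k = Σ_m B_m^{(k)} z^m/m!.
-- Order 0 is the constant series 1; order k+1 is the exponential
-- (binomial) convolution of order k with order 1.
bernK : ℕ → ℕ → ℚ
bernK zero    zero    = ℚ.1ℚ
bernK zero    (suc m) = ℚ.0ℚ
bernK (suc k) m = Σℚ m (λ j → ℕtoℚ (m C j) ℚ.* bernK k j ℚ.* bern1 (m ℕ.∸ j))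

invFact : ℕ → ℚ
invFact m = (_/_ (+ 1) (m !)) {{m !≢0}}

-- Δ^k 0^m = Σ_{j=0}^{k} C(k,j) (-1)^{k-j} j^m   (with 0^0 = 1)
Σℤ : ℕ → (ℕ → ℤ) → ℤ
Σℤ zero    f = f 0
Σℤ (suc n) f = Σℤ n f ℤ.+ f (suc n)

sgn : ℕ → ℤ
sgn zero    = ℤ.1ℤ
sgn (suc n) = ℤ.- sgn n

Δ0 : ℕ → ℕ → ℤ
Δ0 k m = Σℤ k (λ j → (+ (k C j)) ℤ.* sgn (k ℕ.∸ j) ℤ.* (+ (j ℕ.^ m)))

-- q-analogues in a commutative ring R, with a map φ : ℚ → R
-- (intended to be a ring homomorphism, i.e. R a ℚ-algebra, e.g. ℂ)

module QDefs {c ℓ : Level} (R : CommutativeRing c ℓ) (φ : ℚ → CommutativeRing.Carrier R) where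
  open CommutativeRing R

  pow : Carrier → ℕ → Carrier
  pow x zero    = 1#
  pow x (suc n) = x * pow x n

  Σ : ℕ → (ℕ → Carrier) → Carrier
  Σ zero    f = f 0
  Σ (suc n) f = Σ n f + f (suc n)

  -- [n]_q = 1 + q + ... + q^{n-1}  ( = (1-q^n)/(1-q) )
  qint : Carrier → ℕ → Carrier
  qint q zero    = 0#
  qint q (suc n) = qint q n + pow q n

  qfact : Carrier → ℕ → Carrier
  qfact q zero    = 1#
  qfact q (suc n) = qint q (suc n) * qfact q n

  qbinom : Carrier → ℕ → ℕ → Carrier
  qbinom q n       zero    = 1#
  qbinom q zero    (suc k) = 0#
  qbinom q (suc n) (suc k) = qbinom q n k + pow q (suc k) * qbinom q n (suc k)

  qpow1m : Carrier → Carrier → ℕ → Carrier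
  qpow1m q x zero    = 1#
  qpow1m q x (suc m) = qpow1m q x m * (1# - x * pow q m)

  Bkn : Carrier → Carrier → ℕ → ℕ → Carrier
  Bkn q x k n with ℕ._≤?_ k n
  ... | yes _ = qbinom q n k * pow x k * qpow1m q x (n ℕ.∸ k)
  ... | no  _ = 0#

  qfactOverFact : Carrier → ℕ → Carrier
  qfactOverFact q m = qfact q m * φ (invFact m)

  beta : Carrier → Carrier → ℕ → ℕ → Carrier
  beta q x k n = Σ n (λ m → qbinom q n m * qfactOverFact q m
                             * qpow1m q x (n ℕ.∸ m) * φ (bernK k m))

-- Write [l]↓ₛ = [l]_q [l−1]_q ⋯ [l−s+1]_q = (l s)_q [s]_q!. Expanding β, the (m, j) term of
-- the right-hand side carries (l m)_q [m]_q! · (l−m j)_q [j]_q! = [l]↓ₘ₊ⱼ, so grouping by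
-- s = m + j it becomes Σₛ [l]↓ₛ (1−x)_q^{l−s} cₛ, where cₛ = Σ_{m+j=s} (Δᵏ0ᵐ/m!)(B_j^{(k)}/j!)
-- is the coefficient of zˢ in (eᶻ−1)ᵏ (z/(eᶻ−1))ᵏ = zᵏ, because Σₘ Δᵏ0ᵐ zᵐ/m! = (eᶻ−1)ᵏ.
-- Only s = k survives, leaving (l k)_q [k]_q! (1−x)_q^{l−k}; the factor [k]_q! cancels
-- against its inverse.
module Submission where

open import Defs
open import Data.Nat using (ℕ; _∸_)
open import Data.Rational using (ℚ; _/_)
open import Data.Rational.Base using (+-*-rawRing)
open import Algebra.Bundles using (CommutativeRing)
open import Algebra.Morphism.Structures using (module RingMorphisms)

import Algebra.Properties.AbelianGroup as AbelianGroupProperties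
import Algebra.Properties.CommutativeSemigroup as CommutativeSemigroupProperties
import Algebra.Solver.Ring.NaturalCoefficients.Default as NaturalCoefficientsSolver
import Relation.Binary.Reasoning.Setoid as SetoidReasoning
open import Data.Nat as ℕ using (zero; suc; _≤_; _<_; z≤n; s≤s; _!; _≤?_; _≟_; NonZero)
import Data.Nat.Properties as ℕP
open import Data.Nat.Combinatorics as C using (_C_)
import Data.Nat.DivMod as ℕDM
open import Data.Integer as ℤ using (ℤ; +_)
import Data.Integer.Properties as ℤP
import Data.Rational as ℚ
import Data.Rational.Properties as ℚP
import Data.Rational.Unnormalised as ℚᵘ
import Data.Rational.Unnormalised.Properties as ℚᵘP
open import Data.Sum using (inj₁; inj₂)
open import Data.Empty using (⊥-elim)
open import Function using (id)
open import Relation.Binary.PropositionalEquality as ≡ using (_≡_)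
open import Relation.Nullary using (yes; no)

-- QDefs.Σ, like qint, qfact and qbinom, ignores φ; φ only selects the instance of QDefs.
module FiniteSums {c ℓ} (R : CommutativeRing c ℓ) (φ : ℚ → CommutativeRing.Carrier R) where
  open CommutativeRing R hiding (zero)
  open QDefs R φ public using (Σ)
  open CommutativeSemigroupProperties +-commutativeSemigroup using (interchange)
  open AbelianGroupProperties +-abelianGroup using (⁻¹-∙-comm)
  open SetoidReasoning setoid

  Σ-cong≤ : ∀ n {f g : ℕ → Carrier} → (∀ i → i ≤ n → f i ≈ g i) → Σ n f ≈ Σ n g
  Σ-cong≤ zero    f≈g = f≈g 0 z≤n
  Σ-cong≤ (suc n) f≈g =
    +-cong (Σ-cong≤ n (λ i i≤n → f≈g i (ℕP.m≤n⇒m≤1+n i≤n))) (f≈g (suc n) ℕP.≤-refl)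

  Σ-cong : ∀ n {f g : ℕ → Carrier} → (∀ i → f i ≈ g i) → Σ n f ≈ Σ n g
  Σ-cong n f≈g = Σ-cong≤ n (λ i _ → f≈g i)

  Σ-distrib-+ : ∀ n (f g : ℕ → Carrier) → Σ n (λ i → f i + g i) ≈ Σ n f + Σ n g
  Σ-distrib-+ zero    f g = refl
  Σ-distrib-+ (suc n) f g =
    trans (+-cong (Σ-distrib-+ n f g) refl) (interchange _ _ _ _)

  Σ-neg : ∀ n (f : ℕ → Carrier) → Σ n (λ i → - f i) ≈ - Σ n f
  Σ-neg zero    f = refl
  Σ-neg (suc n) f = trans (+-cong (Σ-neg n f) refl) (⁻¹-∙-comm _ _)

  *-distribˡ-Σ : ∀ n a (f : ℕ → Carrier) → a * Σ n f ≈ Σ n (λ i → a * f i)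
  *-distribˡ-Σ zero    a f = refl
  *-distribˡ-Σ (suc n) a f =
    trans (distribˡ a (Σ n f) (f (suc n))) (+-cong (*-distribˡ-Σ n a f) refl)

  *-distribʳ-Σ : ∀ n a (f : ℕ → Carrier) → Σ n f * a ≈ Σ n (λ i → f i * a)
  *-distribʳ-Σ n a f =
    trans (*-comm _ a) (trans (*-distribˡ-Σ n a f) (Σ-cong n (λ i → *-comm a (f i))))

  Σ-suc : ∀ n (f : ℕ → Carrier) → Σ (suc n) f ≈ f 0 + Σ n (λ i → f (suc i))
  Σ-suc zero    f = refl
  Σ-suc (suc n) f = trans (+-cong (Σ-suc n f) refl) (+-assoc _ _ _)

  Σ-reverse : ∀ n (f : ℕ → Carrier) → Σ n f ≈ Σ n (λ i → f (n ∸ i))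
  Σ-reverse zero    f = refl
  Σ-reverse (suc n) f = begin
    Σ n f + f (suc n)                    ≈⟨ +-cong (Σ-reverse n f) refl ⟩
    Σ n (λ i → f (n ∸ i)) + f (suc n)    ≈⟨ +-comm _ _ ⟩
    f (suc n) + Σ n (λ i → f (n ∸ i))    ≈⟨ Σ-suc n (λ i → f (suc n ∸ i)) ⟨
    Σ (suc n) (λ i → f (suc n ∸ i))      ∎

  Σ-comm : ∀ m n (f : ℕ → ℕ → Carrier) →
           Σ m (λ i → Σ n (f i)) ≈ Σ n (λ j → Σ m (λ i → f i j))
  Σ-comm zero    n f = refl
  Σ-comm (suc m) n f = trans (+-cong (Σ-comm m n f) refl) (sym (Σ-distrib-+ n _ _))

  Σ-triangle : ∀ l (f : ℕ → ℕ → Carrier) →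
               Σ l (λ m → Σ (l ∸ m) (f m)) ≈ Σ l (λ s → Σ s (λ m → f m (s ∸ m)))
  Σ-triangle zero    f = refl
  Σ-triangle (suc l) f = begin
    Σ (suc l) (λ m → Σ (suc l ∸ m) (f m))
      ≈⟨ Σ-suc l _ ⟩
    Σ (suc l) (f 0) + Σ l (λ m → Σ (l ∸ m) (f (suc m)))
      ≈⟨ +-cong (Σ-suc l (f 0)) (Σ-triangle l (λ m → f (suc m))) ⟩
    (f 0 0 + Σ l (λ s → f 0 (suc s))) + Σ l (λ s → Σ s (λ m → f (suc m) (s ∸ m)))
      ≈⟨ +-assoc _ _ _ ⟩
    f 0 0 + (Σ l (λ s → f 0 (suc s)) + Σ l (λ s → Σ s (λ m → f (suc m) (s ∸ m))))
      ≈⟨ +-cong refl (Σ-distrib-+ l _ _) ⟨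
    f 0 0 + Σ l (λ s → f 0 (suc s) + Σ s (λ m → f (suc m) (s ∸ m)))
      ≈⟨ +-cong refl (Σ-cong l (λ s → Σ-suc s (λ m → f m (suc s ∸ m)))) ⟨
    f 0 0 + Σ l (λ s → Σ (suc s) (λ m → f m (suc s ∸ m)))
      ≈⟨ Σ-suc l _ ⟨
    Σ (suc l) (λ s → Σ s (λ m → f m (s ∸ m))) ∎

  δ : ℕ → ℕ → Carrier
  δ zero    zero    = 1#
  δ zero    (suc n) = 0#
  δ (suc k) zero    = 0#
  δ (suc k) (suc n) = δ k n

  Σ-δ : ∀ n k (g : ℕ → Carrier) → k ≤ n → Σ n (λ s → g s * δ k s) ≈ g k
  Σ-δ zero    zero    g z≤n       = *-identityʳ (g 0)
  Σ-δ (suc n) zero    g z≤n       = trans (+-cong (Σ-δ n zero g z≤n) (zeroʳ _)) (+-identityʳ _)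
  Σ-δ (suc n) (suc k) g (s≤s k≤n) =
    trans (Σ-suc n _) (trans (+-cong (zeroʳ _) (Σ-δ n k (λ s → g (suc s)) k≤n)) (+-identityˡ _))

  Σ-δ-out : ∀ n k (g : ℕ → Carrier) → n < k → Σ n (λ s → g s * δ k s) ≈ 0#
  Σ-δ-out zero    (suc k) g _         = zeroʳ (g 0)
  Σ-δ-out (suc n) (suc k) g (s≤s n<k) =
    trans (Σ-suc n _) (trans (+-cong (zeroʳ _) (Σ-δ-out n k (λ s → g (suc s)) n<k)) (+-identityˡ 0#))

  -- A sequence ℕ → Carrier stands for the power series Σ aₙ zⁿ: _⋆_ is the
  -- Cauchy product, shift multiplies by z and δ k is zᵏ.
  infixl 7 _⋆_
  _⋆_ : (ℕ → Carrier) → (ℕ → Carrier) → ℕ → Carrier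
  (a ⋆ b) n = Σ n (λ m → a m * b (n ∸ m))

  shift : (ℕ → Carrier) → ℕ → Carrier
  shift a zero    = 0#
  shift a (suc n) = a n

  ⋆-congˡ : ∀ {a a′} b → (∀ i → a i ≈ a′ i) → ∀ n → (a ⋆ b) n ≈ (a′ ⋆ b) n
  ⋆-congˡ b a≈a′ n = Σ-cong n (λ m → *-cong (a≈a′ m) refl)

  ⋆-congʳ : ∀ a {b b′} → (∀ i → b i ≈ b′ i) → ∀ n → (a ⋆ b) n ≈ (a ⋆ b′) n
  ⋆-congʳ a b≈b′ n = Σ-cong n (λ m → *-cong refl (b≈b′ (n ∸ m)))

  ⋆-comm : ∀ a b n → (a ⋆ b) n ≈ (b ⋆ a) n
  ⋆-comm a b n = trans (Σ-reverse n _) (Σ-cong≤ n (λ i i≤n →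
    trans (*-cong refl (reflexive (≡.cong b (ℕP.m∸[m∸n]≡n i≤n)))) (*-comm _ _)))

  ⋆-assoc : ∀ a b c n → ((a ⋆ b) ⋆ c) n ≈ (a ⋆ (b ⋆ c)) n
  ⋆-assoc a b c n = begin
    Σ n (λ s → Σ s (λ m → a m * b (s ∸ m)) * c (n ∸ s))
      ≈⟨ Σ-cong n (λ s → *-distribʳ-Σ s _ _) ⟩
    Σ n (λ s → Σ s (λ m → a m * b (s ∸ m) * c (n ∸ s)))
      ≈⟨ Σ-cong≤ n (λ s s≤n → Σ-cong≤ s (λ m m≤s → trans (*-assoc _ _ _)
           (*-cong refl (*-cong refl (reflexive (≡.cong c (n∸s≡n∸m∸[s∸m] s≤n m≤s))))))) ⟩
    Σ n (λ s → Σ s (λ m → a m * (b (s ∸ m) * c (n ∸ m ∸ (s ∸ m)))))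
      ≈⟨ Σ-triangle n (λ m j → a m * (b j * c (n ∸ m ∸ j))) ⟨
    Σ n (λ m → Σ (n ∸ m) (λ j → a m * (b j * c (n ∸ m ∸ j))))
      ≈⟨ Σ-cong n (λ m → *-distribˡ-Σ (n ∸ m) _ _) ⟨
    (a ⋆ (b ⋆ c)) n ∎
    where
    n∸s≡n∸m∸[s∸m] : ∀ {s m} → s ≤ n → m ≤ s → n ∸ s ≡ n ∸ m ∸ (s ∸ m)
    n∸s≡n∸m∸[s∸m] {s} {m} s≤n m≤s = ≡.trans (≡.cong (n ∸_) (≡.sym (ℕP.m+[n∸m]≡n m≤s)))
                                             (≡.sym (ℕP.∸-+-assoc n m (s ∸ m)))

  ⋆-distribˡ-+ : ∀ a b c n → (a ⋆ (λ i → b i + c i)) n ≈ (a ⋆ b) n + (a ⋆ c) n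
  ⋆-distribˡ-+ a b c n = trans (Σ-cong n (λ m → distribˡ _ _ _)) (Σ-distrib-+ n _ _)

  ⋆-identityˡ : ∀ b n → (δ 0 ⋆ b) n ≈ b n
  ⋆-identityˡ b n = trans (Σ-cong n (λ m → *-comm _ _)) (Σ-δ n 0 (λ m → b (n ∸ m)) z≤n)

  shift-cong : ∀ {a b} → (∀ i → a i ≈ b i) → ∀ n → shift a n ≈ shift b n
  shift-cong a≈b zero    = refl
  shift-cong a≈b (suc n) = a≈b n

  shift-⋆ : ∀ a b n → (shift a ⋆ b) n ≈ shift (a ⋆ b) n
  shift-⋆ a b zero    = zeroˡ _
  shift-⋆ a b (suc n) = trans (Σ-suc n _) (trans (+-cong (zeroˡ _) refl) (+-identityˡ _))

  δ-suc : ∀ k n → δ (suc k) n ≈ shift (δ k) n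
  δ-suc k zero    = refl
  δ-suc k (suc n) = refl

  ⋆-δ₁ : ∀ k n → (δ k ⋆ δ 1) n ≈ δ (suc k) n
  ⋆-δ₁ k n = begin
    (δ k ⋆ δ 1) n           ≈⟨ ⋆-comm (δ k) (δ 1) n ⟩
    (δ 1 ⋆ δ k) n           ≈⟨ ⋆-congˡ (δ k) (δ-suc 0) n ⟩
    (shift (δ 0) ⋆ δ k) n   ≈⟨ shift-⋆ (δ 0) (δ k) n ⟩
    shift (δ 0 ⋆ δ k) n     ≈⟨ shift-cong (⋆-identityˡ (δ k)) n ⟩
    shift (δ k) n           ≈⟨ δ-suc k n ⟨
    δ (suc k) n             ∎

module IntegersInRationals where
  open ≡ using (refl; sym; trans; cong)
  open ℚᵘP.≤-Reasoning

  ι : ℤ → ℚ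
  ι z = z / 1

  toℚᵘ-ι : ∀ z → ℚ.toℚᵘ (ι z) ℚᵘ.≃ ℚᵘ.mkℚᵘ z 0
  toℚᵘ-ι z = ℚP.toℚᵘ-fromℚᵘ (ℚᵘ.mkℚᵘ z 0)

  ι-+ : ∀ a b → ι (a ℤ.+ b) ≡ ι a ℚ.+ ι b
  ι-+ a b = ℚP.toℚᵘ-injective (begin-equality
    ℚ.toℚᵘ (ι (a ℤ.+ b))
      ≃⟨ toℚᵘ-ι _ ⟩
    ℚᵘ.mkℚᵘ (a ℤ.+ b) 0
      ≃⟨ ℚᵘ.*≡* (cong (ℤ._* + 1) (sym (≡.cong₂ ℤ._+_ (ℤP.*-identityʳ a) (ℤP.*-identityʳ b)))) ⟩
    ℚᵘ.mkℚᵘ a 0 ℚᵘ.+ ℚᵘ.mkℚᵘ b 0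
      ≃⟨ ℚᵘP.+-cong (toℚᵘ-ι a) (toℚᵘ-ι b) ⟨
    ℚ.toℚᵘ (ι a) ℚᵘ.+ ℚ.toℚᵘ (ι b)
      ≃⟨ ℚP.toℚᵘ-homo-+ (ι a) (ι b) ⟨
    ℚ.toℚᵘ (ι a ℚ.+ ι b) ∎)

  ι-* : ∀ a b → ι (a ℤ.* b) ≡ ι a ℚ.* ι b
  ι-* a b = ℚP.toℚᵘ-injective (begin-equality
    ℚ.toℚᵘ (ι (a ℤ.* b))                   ≃⟨ toℚᵘ-ι _ ⟩
    ℚᵘ.mkℚᵘ (a ℤ.* b) 0                    ≃⟨ ℚᵘ.*≡* refl ⟩
    ℚᵘ.mkℚᵘ a 0 ℚᵘ.* ℚᵘ.mkℚᵘ b 0           ≃⟨ ℚᵘP.*-cong (toℚᵘ-ι a) (toℚᵘ-ι b) ⟨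
    ℚ.toℚᵘ (ι a) ℚᵘ.* ℚ.toℚᵘ (ι b)         ≃⟨ ℚP.toℚᵘ-homo-* (ι a) (ι b) ⟨
    ℚ.toℚᵘ (ι a ℚ.* ι b)                   ∎)

  ℕtoℚ-* : ∀ a b → ℕtoℚ (a ℕ.* b) ≡ ℕtoℚ a ℚ.* ℕtoℚ b
  ℕtoℚ-* a b = trans (cong ι (ℤP.pos-* a b)) (ι-* (+ a) (+ b))

  1/n*n≡1 : ∀ n .{{_ : NonZero n}} → (+ 1 / n) ℚ.* ℕtoℚ n ≡ ℚ.1ℚ
  1/n*n≡1 zero    {{()}}
  1/n*n≡1 (suc n) = ℚP.toℚᵘ-injective (begin-equality
    ℚ.toℚᵘ ((+ 1 / suc n) ℚ.* ι (+ suc n))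
      ≃⟨ ℚP.toℚᵘ-homo-* (+ 1 / suc n) (ι (+ suc n)) ⟩
    ℚ.toℚᵘ (+ 1 / suc n) ℚᵘ.* ℚ.toℚᵘ (ι (+ suc n))
      ≃⟨ ℚᵘP.*-cong (ℚP.toℚᵘ-fromℚᵘ (ℚᵘ.mkℚᵘ (+ 1) n)) (toℚᵘ-ι (+ suc n)) ⟩
    ℚᵘ.mkℚᵘ (+ 1) n ℚᵘ.* ℚᵘ.mkℚᵘ (+ suc n) 0
      ≃⟨ ℚᵘ.*≡* (trans (ℤP.*-identityʳ _) (cong (λ m → + 1 ℤ.* + m) (sym (ℕP.*-identityʳ (suc n))))) ⟩
    ℚᵘ.1ℚᵘ ∎)

  invFact*!≡1 : ∀ m → invFact m ℚ.* ℕtoℚ (m !) ≡ ℚ.1ℚ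
  invFact*!≡1 m = 1/n*n≡1 (m !) {{m ℕP.!≢0}}

module ForwardDifferencesAtZero where
  open ≡ using (refl; sym; trans; cong; cong₂)
  open ≡.≡-Reasoning
  open FiniteSums ℤP.+-*-commutativeRing (λ _ → ℤ.0ℤ)
  open NaturalCoefficientsSolver (CommutativeRing.commutativeSemiring ℤP.+-*-commutativeRing)

  Σℤ≡Σ : ∀ n f → Σℤ n f ≡ Σ n f
  Σℤ≡Σ zero    f = refl
  Σℤ≡Σ (suc n) f = cong (ℤ._+ f (suc n)) (Σℤ≡Σ n f)

  pos-pascal : ∀ m i → + (suc m C suc i) ≡ + (m C i) ℤ.+ + (m C suc i)
  pos-pascal m i = trans (cong +_ (sym (C.nCk+nC[k+1]≡[n+1]C[k+1] m i))) (ℤP.pos-+ (m C i) (m C suc i))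

  Σ-binomial : ∀ m j → Σ m (λ i → + (m C i) ℤ.* + (j ℕ.^ i)) ≡ + (suc j ℕ.^ m)
  Σ-binomial zero    j = refl
  Σ-binomial (suc m) j = begin
    Σ (suc m) (t (suc m))
      ≡⟨ Σ-suc m (t (suc m)) ⟩
    + 1 ℤ.+ Σ m (λ i → t (suc m) (suc i))
      ≡⟨ cong (ℤ._+_ (+ 1)) (trans (Σ-cong m t-pascal) (Σ-distrib-+ m _ _)) ⟩
    + 1 ℤ.+ (Σ m (λ i → t m i ℤ.* + j) ℤ.+ Q)
      ≡⟨ cong (λ z → + 1 ℤ.+ (z ℤ.+ Q)) (sym (*-distribʳ-Σ m (+ j) (t m))) ⟩
    + 1 ℤ.+ (P ℤ.* + j ℤ.+ Q)
      ≡⟨ solve 3 (λ one a b → one :+ (a :+ b) := a :+ (one :+ b)) refl (+ 1) (P ℤ.* + j) Q ⟩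
    P ℤ.* + j ℤ.+ (+ 1 ℤ.+ Q)
      ≡⟨ cong (ℤ._+_ (P ℤ.* + j)) (trans (sym (Σ-suc m (t m))) t-top) ⟩
    P ℤ.* + j ℤ.+ P
      ≡⟨ solve 2 (λ p a → p :* a :+ p := (con 1 :+ a) :* p) refl P (+ j) ⟩
    + suc j ℤ.* P
      ≡⟨ cong (+ suc j ℤ.*_) (Σ-binomial m j) ⟩
    + suc j ℤ.* + (suc j ℕ.^ m)
      ≡⟨ ℤP.pos-* (suc j) _ ⟨
    + (suc j ℕ.^ suc m) ∎
    where
    t : ℕ → ℕ → ℤ
    t m i = + (m C i) ℤ.* + (j ℕ.^ i)
    P Q : ℤ
    P = Σ m (t m)
    Q = Σ m (λ i → t m (suc i))
    t-pascal : ∀ i → t (suc m) (suc i) ≡ t m i ℤ.* + j ℤ.+ t m (suc i)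
    t-pascal i = begin
      + (suc m C suc i) ℤ.* + (j ℕ.^ suc i)
        ≡⟨ cong₂ ℤ._*_ (pos-pascal m i) (ℤP.pos-* j (j ℕ.^ i)) ⟩
      (+ (m C i) ℤ.+ + (m C suc i)) ℤ.* (+ j ℤ.* + (j ℕ.^ i))
        ≡⟨ solve 4 (λ a b c d → (a :+ b) :* (c :* d) := a :* d :* c :+ b :* (c :* d))
                 refl (+ (m C i)) (+ (m C suc i)) (+ j) (+ (j ℕ.^ i)) ⟩
      t m i ℤ.* + j ℤ.+ + (m C suc i) ℤ.* (+ j ℤ.* + (j ℕ.^ i))
        ≡⟨ cong (λ z → t m i ℤ.* + j ℤ.+ + (m C suc i) ℤ.* z) (ℤP.pos-* j (j ℕ.^ i)) ⟨
      t m i ℤ.* + j ℤ.+ t m (suc i) ∎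
    t-top : Σ (suc m) (t m) ≡ P
    t-top = trans (cong (λ z → P ℤ.+ + z ℤ.* + (j ℕ.^ suc m)) (C.k>n⇒nCk≡0 (ℕP.n<1+n m)))
                  (ℤP.+-identityʳ P)

  signedC : ℕ → ℕ → ℤ
  signedC k j = + (k C j) ℤ.* sgn (k ∸ j)

  Δ0-as-Σ : ∀ k m → Δ0 k m ≡ Σ k (λ j → signedC k j ℤ.* + (j ℕ.^ m))
  Δ0-as-Σ k m = Σℤ≡Σ k _

  -- Δᵏ(1+x)ᵐ at x = 0, which is Δᵏ⁺¹0ᵐ + Δᵏ0ᵐ because the shift operator is 1 + Δ.
  Δ0-shifted : ℕ → ℕ → ℤ
  Δ0-shifted k m = Σ k (λ j → signedC k j ℤ.* + (suc j ℕ.^ m))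

  Σ-binomial-Δ0 : ∀ k m → Σ m (λ i → + (m C i) ℤ.* Δ0 k i) ≡ Δ0-shifted k m
  Σ-binomial-Δ0 k m = begin
    Σ m (λ i → + (m C i) ℤ.* Δ0 k i)
      ≡⟨ Σ-cong m (λ i → trans (cong (+ (m C i) ℤ.*_) (Δ0-as-Σ k i)) (*-distribˡ-Σ k (+ (m C i)) _)) ⟩
    Σ m (λ i → Σ k (λ j → + (m C i) ℤ.* (signedC k j ℤ.* + (j ℕ.^ i))))
      ≡⟨ Σ-comm m k _ ⟩
    Σ k (λ j → Σ m (λ i → + (m C i) ℤ.* (signedC k j ℤ.* + (j ℕ.^ i))))
      ≡⟨ Σ-cong k (λ j → Σ-cong m (λ i → solve 3 (λ a b c → a :* (b :* c) := b :* (a :* c))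
                                                refl (+ (m C i)) (signedC k j) (+ (j ℕ.^ i)))) ⟩
    Σ k (λ j → Σ m (λ i → signedC k j ℤ.* (+ (m C i) ℤ.* + (j ℕ.^ i))))
      ≡⟨ Σ-cong k (λ j → sym (*-distribˡ-Σ m (signedC k j) _)) ⟩
    Σ k (λ j → signedC k j ℤ.* Σ m (λ i → + (m C i) ℤ.* + (j ℕ.^ i)))
      ≡⟨ Σ-cong k (λ j → cong (signedC k j ℤ.*_) (Σ-binomial m j)) ⟩
    Δ0-shifted k m ∎

  neg-Δ0 : ∀ k m → Σ (suc k) (λ j → + (k C j) ℤ.* sgn (suc k ∸ j) ℤ.* + (j ℕ.^ m)) ≡ ℤ.- Δ0 k m
  neg-Δ0 k m = begin
    Σ k (λ j → + (k C j) ℤ.* sgn (suc k ∸ j) ℤ.* + (j ℕ.^ m))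
      ℤ.+ + (k C suc k) ℤ.* sgn (k ∸ k) ℤ.* + (suc k ℕ.^ m)
      ≡⟨ cong₂ ℤ._+_ (Σ-cong≤ k flip-sign)
                     (cong (λ z → + z ℤ.* sgn (k ∸ k) ℤ.* + (suc k ℕ.^ m)) (C.k>n⇒nCk≡0 (ℕP.n<1+n k))) ⟩
    Σ k (λ j → ℤ.- (signedC k j ℤ.* + (j ℕ.^ m))) ℤ.+ ℤ.0ℤ
      ≡⟨ ℤP.+-identityʳ _ ⟩
    Σ k (λ j → ℤ.- (signedC k j ℤ.* + (j ℕ.^ m)))
      ≡⟨ Σ-neg k _ ⟩
    ℤ.- Σ k (λ j → signedC k j ℤ.* + (j ℕ.^ m))
      ≡⟨ cong ℤ.-_ (Δ0-as-Σ k m) ⟨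
    ℤ.- Δ0 k m ∎
    where
    flip-sign : ∀ j → j ≤ k →
                + (k C j) ℤ.* sgn (suc k ∸ j) ℤ.* + (j ℕ.^ m) ≡ ℤ.- (signedC k j ℤ.* + (j ℕ.^ m))
    flip-sign j j≤k = begin
      + (k C j) ℤ.* sgn (suc k ∸ j) ℤ.* + (j ℕ.^ m)
        ≡⟨ cong (λ i → + (k C j) ℤ.* sgn i ℤ.* + (j ℕ.^ m)) (ℕP.+-∸-assoc 1 j≤k) ⟩
      + (k C j) ℤ.* ℤ.- sgn (k ∸ j) ℤ.* + (j ℕ.^ m)
        ≡⟨ cong (ℤ._* + (j ℕ.^ m)) (ℤP.neg-distribʳ-* (+ (k C j)) (sgn (k ∸ j))) ⟨
      ℤ.- signedC k j ℤ.* + (j ℕ.^ m)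
        ≡⟨ ℤP.neg-distribˡ-* (signedC k j) (+ (j ℕ.^ m)) ⟨
      ℤ.- (signedC k j ℤ.* + (j ℕ.^ m)) ∎

  Δ0-suc+Δ0 : ∀ k m → Δ0 (suc k) m ℤ.+ Δ0 k m ≡ Δ0-shifted k m
  Δ0-suc+Δ0 k m = begin
    Δ0 (suc k) m ℤ.+ Δ0 k m
      ≡⟨ cong (ℤ._+ Δ0 k m) (trans (Δ0-as-Σ (suc k) m) (Σ-suc k _)) ⟩
    (first ℤ.+ Σ k (λ j → signedC (suc k) (suc j) ℤ.* + (suc j ℕ.^ m))) ℤ.+ Δ0 k m
      ≡⟨ cong (λ z → (first ℤ.+ z) ℤ.+ Δ0 k m) (trans (Σ-cong k split-pascal) (Σ-distrib-+ k _ _)) ⟩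
    (first ℤ.+ (Δ0-shifted k m ℤ.+ rest)) ℤ.+ Δ0 k m
      ≡⟨ solve 4 (λ a b c d → (a :+ (b :+ c)) :+ d := b :+ ((a :+ c) :+ d))
               refl first (Δ0-shifted k m) rest (Δ0 k m) ⟩
    Δ0-shifted k m ℤ.+ ((first ℤ.+ rest) ℤ.+ Δ0 k m)
      ≡⟨ cong (λ z → Δ0-shifted k m ℤ.+ (z ℤ.+ Δ0 k m)) (trans (sym (Σ-suc k _)) (neg-Δ0 k m)) ⟩
    Δ0-shifted k m ℤ.+ (ℤ.- Δ0 k m ℤ.+ Δ0 k m)
      ≡⟨ cong (ℤ._+_ (Δ0-shifted k m)) (ℤP.+-inverseˡ (Δ0 k m)) ⟩
    Δ0-shifted k m ℤ.+ ℤ.0ℤ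
      ≡⟨ ℤP.+-identityʳ _ ⟩
    Δ0-shifted k m ∎
    where
    first = signedC (suc k) 0 ℤ.* + (0 ℕ.^ m)
    rest  = Σ k (λ j → + (k C suc j) ℤ.* sgn (k ∸ j) ℤ.* + (suc j ℕ.^ m))
    split-pascal : ∀ j → signedC (suc k) (suc j) ℤ.* + (suc j ℕ.^ m)
                       ≡ signedC k j ℤ.* + (suc j ℕ.^ m) ℤ.+ + (k C suc j) ℤ.* sgn (k ∸ j) ℤ.* + (suc j ℕ.^ m)
    split-pascal j = trans (cong (λ z → z ℤ.* sgn (k ∸ j) ℤ.* + (suc j ℕ.^ m)) (pos-pascal k j))
      (solve 4 (λ a b s p → (a :+ b) :* s :* p := a :* s :* p :+ b :* s :* p)
             refl (+ (k C j)) (+ (k C suc j)) (sgn (k ∸ j)) (+ (suc j ℕ.^ m)))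

  Δ0-binomial : ∀ k m → Σℤ m (λ i → + (m C i) ℤ.* Δ0 k i) ≡ Δ0 (suc k) m ℤ.+ Δ0 k m
  Δ0-binomial k m = trans (Σℤ≡Σ m _) (trans (Σ-binomial-Δ0 k m) (sym (Δ0-suc+Δ0 k m)))

module ExponentialGeneratingFunctions where
  open ≡ using (refl; sym; trans; cong; cong₂)
  open ≡.≡-Reasoning
  open IntegersInRationals
  open ForwardDifferencesAtZero using (Δ0-binomial)
  open FiniteSums ℚP.+-*-commutativeRing id public
  open NaturalCoefficientsSolver (CommutativeRing.commutativeSemiring ℚP.+-*-commutativeRing)
  open import Algebra.Properties.Group ℚP.+-0-group using (∙-cancelʳ)

  Σℚ≡Σ : ∀ n f → Σℚ n f ≡ Σ n f
  Σℚ≡Σ zero    f = refl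
  Σℚ≡Σ (suc n) f = cong (ℚ._+ f (suc n)) (Σℚ≡Σ n f)

  ι-Σℤ : ∀ n f → ι (Σℤ n f) ≡ Σ n (λ i → ι (f i))
  ι-Σℤ zero    f = refl
  ι-Σℤ (suc n) f = trans (ι-+ (Σℤ n f) (f (suc n))) (cong (ℚ._+ ι (f (suc n))) (ι-Σℤ n f))

  nCk*k!*[n∸k]!≡n! : ∀ {n k} → k ≤ n → (n C k) ℕ.* (k ! ℕ.* (n ∸ k) !) ≡ n !
  nCk*k!*[n∸k]!≡n! {n} {k} k≤n =
    trans (cong (ℕ._* (k ! ℕ.* (n ∸ k) !)) (C.nCk≡n!/k![n-k]! k≤n))
          (ℕDM.m/n*n≡m {{ℕP.m*n≢0 (k !) ((n ∸ k) !) {{k ℕP.!≢0}} {{(n ∸ k) ℕP.!≢0}}}}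
                       (C.k![n∸k]!∣n! k≤n))

  nCk*invFact≡invFact*invFact : ∀ {n k} → k ≤ n →
                                ℕtoℚ (n C k) ℚ.* invFact n ≡ invFact k ℚ.* invFact (n ∸ k)
  nCk*invFact≡invFact*invFact {n} {k} k≤n = begin
    c ℚ.* i ≡⟨ ℚP.*-identityʳ _ ⟨
    c ℚ.* i ℚ.* ℚ.1ℚ
      ≡⟨ cong (c ℚ.* i ℚ.*_) (trans (cong₂ ℚ._*_ (invFact*!≡1 k) (invFact*!≡1 (n ∸ k)))
                                    (ℚP.*-identityˡ ℚ.1ℚ)) ⟨
    c ℚ.* i ℚ.* ((i₁ ℚ.* a) ℚ.* (i₂ ℚ.* b))
      ≡⟨ solve 6 (λ c i i₁ i₂ a b → c :* i :* ((i₁ :* a) :* (i₂ :* b)) := (c :* (a :* b)) :* i :* (i₁ :* i₂))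
               refl c i i₁ i₂ a b ⟩
    (c ℚ.* (a ℚ.* b)) ℚ.* i ℚ.* (i₁ ℚ.* i₂)
      ≡⟨ cong (λ z → z ℚ.* i ℚ.* (i₁ ℚ.* i₂))
              (trans (ℕtoℚ-* (n C k) _) (cong (c ℚ.*_) (ℕtoℚ-* (k !) ((n ∸ k) !)))) ⟨
    ℕtoℚ ((n C k) ℕ.* (k ! ℕ.* (n ∸ k) !)) ℚ.* i ℚ.* (i₁ ℚ.* i₂)
      ≡⟨ cong (λ z → ℕtoℚ z ℚ.* i ℚ.* (i₁ ℚ.* i₂)) (nCk*k!*[n∸k]!≡n! k≤n) ⟩
    ℕtoℚ (n !) ℚ.* i ℚ.* (i₁ ℚ.* i₂)
      ≡⟨ cong (ℚ._* (i₁ ℚ.* i₂)) (trans (ℚP.*-comm (ℕtoℚ (n !)) i) (invFact*!≡1 n)) ⟩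
    ℚ.1ℚ ℚ.* (i₁ ℚ.* i₂)
      ≡⟨ ℚP.*-identityˡ _ ⟩
    i₁ ℚ.* i₂ ∎
    where
    c = ℕtoℚ (n C k); i = invFact n; i₁ = invFact k; i₂ = invFact (n ∸ k)
    a = ℕtoℚ (k !); b = ℕtoℚ ((n ∸ k) !)

  bern1-suc : ∀ n → bern1 (suc n) ≡
    ℚ.- ((+ 1 / suc (suc n)) ℚ.* Σℚ n (λ j → ℕtoℚ (suc (suc n) C j) ℚ.* bernTab n j))
  bern1-suc n with suc n ≟ suc n
  ... | yes _  = refl
  ... | no 1+n≢1+n = ⊥-elim (1+n≢1+n refl)

  bernTab-stable : ∀ n j → j ≤ n → bernTab n j ≡ bern1 j
  bernTab-stable zero    zero z≤n = refl
  bernTab-stable (suc n) j j≤1+n with j ≟ suc n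
  ... | yes refl = sym (bern1-suc n)
  ... | no  j≢1+n = bernTab-stable n j (ℕP.≤-pred (ℕP.≤∧≢⇒< j≤1+n j≢1+n))

  [1+n]Cn≡1+n : ∀ n → suc n C n ≡ suc n
  [1+n]Cn≡1+n n = trans (C.nCk≡nC[n∸k] (ℕP.n≤1+n n))
                        (trans (cong (suc n C_) (ℕP.m+n∸n≡m 1 n)) (C.nC1≡n (suc n)))

  Σ-C-bern1≡0 : ∀ n → Σ (suc n) (λ j → ℕtoℚ (suc (suc n) C j) ℚ.* bern1 j) ≡ ℚ.0ℚ
  Σ-C-bern1≡0 n = begin
    S ℚ.+ ℕtoℚ (suc (suc n) C suc n) ℚ.* bern1 (suc n)
      ≡⟨ cong₂ (λ a b → S ℚ.+ ℕtoℚ a ℚ.* b) ([1+n]Cn≡1+n (suc n)) (bern1-suc n) ⟩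
    S ℚ.+ N ℚ.* ℚ.- (1/N ℚ.* Σℚ n (λ j → ℕtoℚ (suc (suc n) C j) ℚ.* bernTab n j))
      ≡⟨ cong (λ z → S ℚ.+ N ℚ.* ℚ.- (1/N ℚ.* z))
              (trans (Σℚ≡Σ n _) (Σ-cong≤ n (λ j j≤n →
                 cong (ℕtoℚ (suc (suc n) C j) ℚ.*_) (bernTab-stable n j j≤n)))) ⟩
    S ℚ.+ N ℚ.* ℚ.- (1/N ℚ.* S)
      ≡⟨ cong (S ℚ.+_) (ℚP.neg-distribʳ-* N (1/N ℚ.* S)) ⟨
    S ℚ.+ ℚ.- (N ℚ.* (1/N ℚ.* S))
      ≡⟨ cong (λ z → S ℚ.+ ℚ.- z) (trans (sym (ℚP.*-assoc N 1/N S))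
            (trans (cong (ℚ._* S) (trans (ℚP.*-comm N 1/N) (1/n*n≡1 (suc (suc n))))) (ℚP.*-identityˡ S))) ⟩
    S ℚ.+ ℚ.- S
      ≡⟨ ℚP.+-inverseʳ S ⟩
    ℚ.0ℚ ∎
    where
    S = Σ n (λ j → ℕtoℚ (suc (suc n) C j) ℚ.* bern1 j)
    N = ℕtoℚ (suc (suc n))
    1/N = + 1 / suc (suc n)

  -- Coefficient sequences of exponential generating functions:
  -- egfBernoulli k is (z/(eᶻ−1))ᵏ, egfBernoulli₁ is z/(eᶻ−1), egfΔ0 k is (eᶻ−1)ᵏ.
  exp expm1/z expm1 egfBernoulli₁ : ℕ → ℚ
  exp m = invFact m
  expm1/z m = invFact (suc m)
  expm1 = shift expm1/z
  egfBernoulli₁ m = bern1 m ℚ.* invFact m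

  egfBernoulli egfΔ0 : ℕ → ℕ → ℚ
  egfBernoulli k m = bernK k m ℚ.* invFact m
  egfΔ0 k m = ι (Δ0 k m) ℚ.* invFact m

  egfBernoulli₁⋆expm1/z : ∀ n → (egfBernoulli₁ ⋆ expm1/z) n ≡ δ 0 n
  egfBernoulli₁⋆expm1/z zero    = refl
  egfBernoulli₁⋆expm1/z (suc n) = begin
    (egfBernoulli₁ ⋆ expm1/z) (suc n)
      ≡⟨ Σ-cong≤ (suc n) term ⟩
    Σ (suc n) (λ j → invFact (suc (suc n)) ℚ.* (ℕtoℚ (suc (suc n) C j) ℚ.* bern1 j))
      ≡⟨ *-distribˡ-Σ (suc n) (invFact (suc (suc n))) _ ⟨
    invFact (suc (suc n)) ℚ.* Σ (suc n) (λ j → ℕtoℚ (suc (suc n) C j) ℚ.* bern1 j)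
      ≡⟨ cong (invFact (suc (suc n)) ℚ.*_) (Σ-C-bern1≡0 n) ⟩
    invFact (suc (suc n)) ℚ.* ℚ.0ℚ
      ≡⟨ ℚP.*-zeroʳ (invFact (suc (suc n))) ⟩
    ℚ.0ℚ ∎
    where
    term : ∀ j → j ≤ suc n → egfBernoulli₁ j ℚ.* expm1/z (suc n ∸ j)
                           ≡ invFact (suc (suc n)) ℚ.* (ℕtoℚ (suc (suc n) C j) ℚ.* bern1 j)
    term j j≤1+n = begin
      bern1 j ℚ.* invFact j ℚ.* invFact (suc (suc n ∸ j))
        ≡⟨ cong (λ i → bern1 j ℚ.* invFact j ℚ.* invFact i) (ℕP.+-∸-assoc 1 j≤1+n) ⟨
      bern1 j ℚ.* invFact j ℚ.* invFact (suc (suc n) ∸ j)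
        ≡⟨ ℚP.*-assoc (bern1 j) (invFact j) _ ⟩
      bern1 j ℚ.* (invFact j ℚ.* invFact (suc (suc n) ∸ j))
        ≡⟨ cong (bern1 j ℚ.*_) (nCk*invFact≡invFact*invFact (ℕP.m≤n⇒m≤1+n j≤1+n)) ⟨
      bern1 j ℚ.* (ℕtoℚ (suc (suc n) C j) ℚ.* invFact (suc (suc n)))
        ≡⟨ solve 3 (λ a b c → a :* (b :* c) := c :* (b :* a))
                 refl (bern1 j) (ℕtoℚ (suc (suc n) C j)) (invFact (suc (suc n))) ⟩
      invFact (suc (suc n)) ℚ.* (ℕtoℚ (suc (suc n) C j) ℚ.* bern1 j) ∎

  expm1⋆egfBernoulli₁ : ∀ n → (expm1 ⋆ egfBernoulli₁) n ≡ δ 1 n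
  expm1⋆egfBernoulli₁ zero    = refl
  expm1⋆egfBernoulli₁ (suc n) = begin
    (expm1 ⋆ egfBernoulli₁) (suc n)   ≡⟨ shift-⋆ expm1/z egfBernoulli₁ (suc n) ⟩
    (expm1/z ⋆ egfBernoulli₁) n       ≡⟨ ⋆-comm expm1/z egfBernoulli₁ n ⟩
    (egfBernoulli₁ ⋆ expm1/z) n       ≡⟨ egfBernoulli₁⋆expm1/z n ⟩
    δ 0 n                             ∎

  egfBernoulli-zero : ∀ m → egfBernoulli 0 m ≡ δ 0 m
  egfBernoulli-zero zero    = refl
  egfBernoulli-zero (suc m) = ℚP.*-zeroˡ (invFact (suc m))

  egfBernoulli-suc : ∀ k m → egfBernoulli (suc k) m ≡ (egfBernoulli k ⋆ egfBernoulli₁) m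
  egfBernoulli-suc k m = begin
    Σℚ m (λ j → ℕtoℚ (m C j) ℚ.* bernK k j ℚ.* bern1 (m ∸ j)) ℚ.* invFact m
      ≡⟨ cong (ℚ._* invFact m) (Σℚ≡Σ m _) ⟩
    Σ m (λ j → ℕtoℚ (m C j) ℚ.* bernK k j ℚ.* bern1 (m ∸ j)) ℚ.* invFact m
      ≡⟨ *-distribʳ-Σ m (invFact m) _ ⟩
    Σ m (λ j → ℕtoℚ (m C j) ℚ.* bernK k j ℚ.* bern1 (m ∸ j) ℚ.* invFact m)
      ≡⟨ Σ-cong≤ m term ⟩
    (egfBernoulli k ⋆ egfBernoulli₁) m ∎
    where
    term : ∀ j → j ≤ m → ℕtoℚ (m C j) ℚ.* bernK k j ℚ.* bern1 (m ∸ j) ℚ.* invFact m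
                       ≡ egfBernoulli k j ℚ.* egfBernoulli₁ (m ∸ j)
    term j j≤m = begin
      ℕtoℚ (m C j) ℚ.* bernK k j ℚ.* bern1 (m ∸ j) ℚ.* invFact m
        ≡⟨ solve 4 (λ c b b₁ i → c :* b :* b₁ :* i := b :* b₁ :* (c :* i))
                 refl (ℕtoℚ (m C j)) (bernK k j) (bern1 (m ∸ j)) (invFact m) ⟩
      bernK k j ℚ.* bern1 (m ∸ j) ℚ.* (ℕtoℚ (m C j) ℚ.* invFact m)
        ≡⟨ cong (bernK k j ℚ.* bern1 (m ∸ j) ℚ.*_) (nCk*invFact≡invFact*invFact j≤m) ⟩
      bernK k j ℚ.* bern1 (m ∸ j) ℚ.* (invFact j ℚ.* invFact (m ∸ j))
        ≡⟨ solve 4 (λ b b₁ i i₁ → b :* b₁ :* (i :* i₁) := (b :* i) :* (b₁ :* i₁))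
                 refl (bernK k j) (bern1 (m ∸ j)) (invFact j) (invFact (m ∸ j)) ⟩
      egfBernoulli k j ℚ.* egfBernoulli₁ (m ∸ j) ∎

  egfΔ0-zero : ∀ m → egfΔ0 0 m ≡ δ 0 m
  egfΔ0-zero zero    = refl
  egfΔ0-zero (suc m) = ℚP.*-zeroˡ (invFact (suc m))

  egfΔ0⋆exp : ∀ k m → (egfΔ0 k ⋆ exp) m ≡ egfΔ0 (suc k) m ℚ.+ egfΔ0 k m
  egfΔ0⋆exp k m = begin
    Σ m (λ i → ι (Δ0 k i) ℚ.* invFact i ℚ.* invFact (m ∸ i))
      ≡⟨ Σ-cong≤ m term ⟩
    Σ m (λ i → invFact m ℚ.* (ι (+ (m C i)) ℚ.* ι (Δ0 k i)))
      ≡⟨ *-distribˡ-Σ m (invFact m) _ ⟨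
    invFact m ℚ.* Σ m (λ i → ι (+ (m C i)) ℚ.* ι (Δ0 k i))
      ≡⟨ cong (invFact m ℚ.*_) (trans (ι-Σℤ m _) (Σ-cong m (λ i → ι-* (+ (m C i)) (Δ0 k i)))) ⟨
    invFact m ℚ.* ι (Σℤ m (λ i → + (m C i) ℤ.* Δ0 k i))
      ≡⟨ cong (λ z → invFact m ℚ.* ι z) (Δ0-binomial k m) ⟩
    invFact m ℚ.* ι (Δ0 (suc k) m ℤ.+ Δ0 k m)
      ≡⟨ cong (invFact m ℚ.*_) (ι-+ (Δ0 (suc k) m) (Δ0 k m)) ⟩
    invFact m ℚ.* (ι (Δ0 (suc k) m) ℚ.+ ι (Δ0 k m))
      ≡⟨ solve 3 (λ i a b → i :* (a :+ b) := a :* i :+ b :* i)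
               refl (invFact m) (ι (Δ0 (suc k) m)) (ι (Δ0 k m)) ⟩
    egfΔ0 (suc k) m ℚ.+ egfΔ0 k m ∎
    where
    term : ∀ i → i ≤ m → ι (Δ0 k i) ℚ.* invFact i ℚ.* invFact (m ∸ i)
                       ≡ invFact m ℚ.* (ι (+ (m C i)) ℚ.* ι (Δ0 k i))
    term i i≤m = begin
      ι (Δ0 k i) ℚ.* invFact i ℚ.* invFact (m ∸ i)
        ≡⟨ ℚP.*-assoc (ι (Δ0 k i)) (invFact i) (invFact (m ∸ i)) ⟩
      ι (Δ0 k i) ℚ.* (invFact i ℚ.* invFact (m ∸ i))
        ≡⟨ cong (ι (Δ0 k i) ℚ.*_) (nCk*invFact≡invFact*invFact i≤m) ⟨
      ι (Δ0 k i) ℚ.* (ℕtoℚ (m C i) ℚ.* invFact m)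
        ≡⟨ solve 3 (λ a b c → a :* (b :* c) := c :* (b :* a)) refl (ι (Δ0 k i)) (ℕtoℚ (m C i)) (invFact m) ⟩
      invFact m ℚ.* (ι (+ (m C i)) ℚ.* ι (Δ0 k i)) ∎

  exp≡expm1+δ0 : ∀ i → exp i ≡ expm1 i ℚ.+ δ 0 i
  exp≡expm1+δ0 zero    = refl
  exp≡expm1+δ0 (suc i) = sym (ℚP.+-identityʳ (invFact (suc i)))

  egfΔ0-suc : ∀ k m → egfΔ0 (suc k) m ≡ (egfΔ0 k ⋆ expm1) m
  egfΔ0-suc k m = ∙-cancelʳ (egfΔ0 k m) _ _ (begin
    egfΔ0 (suc k) m ℚ.+ egfΔ0 k m                ≡⟨ egfΔ0⋆exp k m ⟨
    (egfΔ0 k ⋆ exp) m                            ≡⟨ ⋆-congʳ (egfΔ0 k) exp≡expm1+δ0 m ⟩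
    (egfΔ0 k ⋆ (λ i → expm1 i ℚ.+ δ 0 i)) m      ≡⟨ ⋆-distribˡ-+ (egfΔ0 k) expm1 (δ 0) m ⟩
    (egfΔ0 k ⋆ expm1) m ℚ.+ (egfΔ0 k ⋆ δ 0) m    ≡⟨ cong ((egfΔ0 k ⋆ expm1) m ℚ.+_) ⋆-identityʳ ⟩
    (egfΔ0 k ⋆ expm1) m ℚ.+ egfΔ0 k m            ∎)
    where
    ⋆-identityʳ : (egfΔ0 k ⋆ δ 0) m ≡ egfΔ0 k m
    ⋆-identityʳ = trans (⋆-comm (egfΔ0 k) (δ 0) m) (⋆-identityˡ (egfΔ0 k) m)

  egfΔ0⋆egfBernoulli : ∀ k s → (egfΔ0 k ⋆ egfBernoulli k) s ≡ δ k s
  egfΔ0⋆egfBernoulli zero s = begin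
    (egfΔ0 0 ⋆ egfBernoulli 0) s    ≡⟨ ⋆-congˡ (egfBernoulli 0) egfΔ0-zero s ⟩
    (δ 0 ⋆ egfBernoulli 0) s        ≡⟨ ⋆-identityˡ (egfBernoulli 0) s ⟩
    egfBernoulli 0 s                ≡⟨ egfBernoulli-zero s ⟩
    δ 0 s                           ∎
  egfΔ0⋆egfBernoulli (suc k) s = begin
    (egfΔ0 (suc k) ⋆ egfBernoulli (suc k)) s  ≡⟨ ⋆-congˡ (egfBernoulli (suc k)) (egfΔ0-suc k) s ⟩
    ((d ⋆ expm1) ⋆ egfBernoulli (suc k)) s    ≡⟨ ⋆-congʳ (d ⋆ expm1) (egfBernoulli-suc k) s ⟩
    ((d ⋆ expm1) ⋆ (b ⋆ egfBernoulli₁)) s     ≡⟨ ⋆-assoc d expm1 (b ⋆ egfBernoulli₁) s ⟩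
    (d ⋆ (expm1 ⋆ (b ⋆ egfBernoulli₁))) s     ≡⟨ ⋆-congʳ d (λ i → ⋆-assoc expm1 b egfBernoulli₁ i) s ⟨
    (d ⋆ ((expm1 ⋆ b) ⋆ egfBernoulli₁)) s     ≡⟨ ⋆-congʳ d (⋆-congˡ egfBernoulli₁ (⋆-comm expm1 b)) s ⟩
    (d ⋆ ((b ⋆ expm1) ⋆ egfBernoulli₁)) s     ≡⟨ ⋆-congʳ d (⋆-assoc b expm1 egfBernoulli₁) s ⟩
    (d ⋆ (b ⋆ (expm1 ⋆ egfBernoulli₁))) s     ≡⟨ ⋆-assoc d b (expm1 ⋆ egfBernoulli₁) s ⟨
    ((d ⋆ b) ⋆ (expm1 ⋆ egfBernoulli₁)) s     ≡⟨ ⋆-congˡ (expm1 ⋆ egfBernoulli₁) (egfΔ0⋆egfBernoulli k) s ⟩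
    (δ k ⋆ (expm1 ⋆ egfBernoulli₁)) s         ≡⟨ ⋆-congʳ (δ k) expm1⋆egfBernoulli₁ s ⟩
    (δ k ⋆ δ 1) s                             ≡⟨ ⋆-δ₁ k s ⟩
    δ (suc k) s                               ∎
    where
    d = egfΔ0 k
    b = egfBernoulli k

module QFallingFactorials {c ℓ} (R : CommutativeRing c ℓ) (φ : ℚ → CommutativeRing.Carrier R)
                          (q : CommutativeRing.Carrier R) where
  open CommutativeRing R hiding (zero)
  open QDefs R φ
  open SetoidReasoning setoid
  open NaturalCoefficientsSolver commutativeSemiring

  qint-suc : ∀ n → qint q (suc n) ≈ 1# + q * qint q n
  qint-suc zero    = trans (+-identityˡ 1#) (sym (trans (+-cong refl (zeroʳ q)) (+-identityʳ 1#)))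
  qint-suc (suc n) = begin
    qint q (suc n) + q * pow q n        ≈⟨ +-cong (qint-suc n) refl ⟩
    1# + q * qint q n + q * pow q n     ≈⟨ solve 4 (λ o a b c → o :+ a :* b :+ a :* c := o :+ a :* (b :+ c))
                                                 refl 1# q (qint q n) (pow q n) ⟩
    1# + q * (qint q n + pow q n)       ∎

  qint-+ : ∀ a b → qint q (a ℕ.+ b) ≈ qint q a + pow q a * qint q b
  qint-+ zero    b = sym (trans (+-identityˡ _) (*-identityˡ _))
  qint-+ (suc a) b = begin
    qint q (suc (a ℕ.+ b))                ≈⟨ qint-suc (a ℕ.+ b) ⟩
    1# + q * qint q (a ℕ.+ b)             ≈⟨ +-cong refl (*-cong refl (qint-+ a b)) ⟩
    1# + q * (qint q a + pow q a * qint q b)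
      ≈⟨ solve 5 (λ o r x p y → o :+ r :* (x :+ p :* y) := o :+ r :* x :+ r :* p :* y)
               refl 1# q (qint q a) (pow q a) (qint q b) ⟩
    1# + q * qint q a + pow q (suc a) * qint q b ≈⟨ +-cong (qint-suc a) refl ⟨
    qint q (suc a) + pow q (suc a) * qint q b ∎

  qfalling : ℕ → ℕ → Carrier
  qfalling n zero    = 1#
  qfalling n (suc m) = qfalling n m * qint q (n ∸ m)

  qfalling-vanishes : ∀ {n m} → n < m → qfalling n m ≈ 0#
  qfalling-vanishes {n} {suc m} (s≤s n≤m) with ℕP.m≤n⇒m<n∨m≡n n≤m
  ... | inj₁ n<m    = trans (*-cong (qfalling-vanishes n<m) refl) (zeroˡ _)
  ... | inj₂ ≡.refl = trans (*-cong refl (reflexive (≡.cong (qint q) (ℕP.n∸n≡0 n)))) (zeroʳ _)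

  qbinom*qfact≈qfalling : ∀ n m → qbinom q n m * qfact q m ≈ qfalling n m
  qbinom*qfact≈qfalling n       zero    = *-identityˡ 1#
  qbinom*qfact≈qfalling zero    (suc m) = trans (zeroˡ _) (sym (qfalling-vanishes {0} {suc m} (s≤s z≤n)))
  qbinom*qfact≈qfalling (suc n) (suc m) = begin
    (qbinom q n m + pow q (suc m) * qbinom q n (suc m)) * (qint q (suc m) * qfact q m)
      ≈⟨ solve 5 (λ a p b i f → (a :+ p :* b) :* (i :* f) := i :* (a :* f) :+ p :* (b :* (i :* f)))
               refl (qbinom q n m) (pow q (suc m)) (qbinom q n (suc m)) (qint q (suc m)) (qfact q m) ⟩
    qint q (suc m) * (qbinom q n m * qfact q m) + pow q (suc m) * (qbinom q n (suc m) * qfact q (suc m))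
      ≈⟨ +-cong (*-cong refl (qbinom*qfact≈qfalling n m)) (*-cong refl (qbinom*qfact≈qfalling n (suc m))) ⟩
    qint q (suc m) * qfalling n m + pow q (suc m) * (qfalling n m * qint q (n ∸ m))
      ≈⟨ solve 4 (λ i f p j → i :* f :+ p :* (f :* j) := (i :+ p :* j) :* f)
               refl (qint q (suc m)) (qfalling n m) (pow q (suc m)) (qint q (n ∸ m)) ⟩
    (qint q (suc m) + pow q (suc m) * qint q (n ∸ m)) * qfalling n m
      ≈⟨ qint-sum ⟩
    qint q (suc n) * qfalling n m
      ≈⟨ qfalling-suc n m ⟨
    qfalling (suc n) (suc m) ∎
    where
    qfalling-suc : ∀ n m → qfalling (suc n) (suc m) ≈ qint q (suc n) * qfalling n m
    qfalling-suc n zero    = *-comm _ _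
    qfalling-suc n (suc m) = trans (*-cong (qfalling-suc n m) refl) (*-assoc _ _ _)
    qint-sum : (qint q (suc m) + pow q (suc m) * qint q (n ∸ m)) * qfalling n m
             ≈ qint q (suc n) * qfalling n m
    qint-sum with m ≤? n
    ... | yes m≤n = *-cong (trans (sym (qint-+ (suc m) (n ∸ m)))
                                  (reflexive (≡.cong (λ i → qint q (suc i)) (ℕP.m+[n∸m]≡n m≤n)))) refl
    ... | no  m≰n = trans (*-cong refl vanishes)
                          (trans (zeroʳ _) (sym (trans (*-cong refl vanishes) (zeroʳ _))))
      where vanishes = qfalling-vanishes (ℕP.≰⇒> m≰n)

  qfalling-+ : ∀ l m j → qfalling l m * qfalling (l ∸ m) j ≈ qfalling l (m ℕ.+ j)
  qfalling-+ l m zero    =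
    trans (*-identityʳ _) (reflexive (≡.cong (qfalling l) (≡.sym (ℕP.+-identityʳ m))))
  qfalling-+ l m (suc j) = begin
    qfalling l m * (qfalling (l ∸ m) j * qint q (l ∸ m ∸ j))
      ≈⟨ *-assoc _ _ _ ⟨
    qfalling l m * qfalling (l ∸ m) j * qint q (l ∸ m ∸ j)
      ≈⟨ *-cong (qfalling-+ l m j) (reflexive (≡.cong (qint q) (ℕP.∸-+-assoc l m j))) ⟩
    qfalling l (suc (m ℕ.+ j))
      ≈⟨ reflexive (≡.cong (qfalling l) (≡.sym (ℕP.+-suc m j))) ⟩
    qfalling l (m ℕ.+ suc j) ∎

module BernsteinExpansion {c ℓ} (R : CommutativeRing c ℓ) (φ : ℚ → CommutativeRing.Carrier R)
  (φ-hom : RingMorphisms.IsRingHomomorphism +-*-rawRing (CommutativeRing.rawRing R) φ)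
  (q x : CommutativeRing.Carrier R) (k l : ℕ) where
  open CommutativeRing R hiding (zero)
  open QDefs R φ hiding (Σ)
  open FiniteSums R φ
  open QFallingFactorials R φ q
  open RingMorphisms.IsRingHomomorphism φ-hom
  open SetoidReasoning setoid
  open NaturalCoefficientsSolver commutativeSemiring
  module EGF = ExponentialGeneratingFunctions

  φ-Σ : ∀ n f → φ (EGF.Σ n f) ≈ Σ n (λ i → φ (f i))
  φ-Σ zero    f = refl
  φ-Σ (suc n) f = trans (+-homo (EGF.Σ n f) (f (suc n))) (+-cong (φ-Σ n f) refl)

  φ-δ : ∀ k s → φ (EGF.δ k s) ≈ δ k s
  φ-δ zero    zero    = 1#-homo
  φ-δ zero    (suc s) = 0#-homo
  φ-δ (suc k) zero    = 0#-homo
  φ-δ (suc k) (suc s) = φ-δ k s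

  summand : ℕ → Carrier
  summand m = ((qfactOverFact q m * qbinom q l m) * beta q x k (l ∸ m)) * φ (Δ0 k m / 1)

  expandedTerm : ℕ → ℕ → Carrier
  expandedTerm m j = qfalling l (m ℕ.+ j) * qpow1m q x (l ∸ (m ℕ.+ j))
                   * φ (EGF.egfΔ0 k m ℚ.* EGF.egfBernoulli k j)

  summand-expansion : ∀ m → summand m ≈ Σ (l ∸ m) (expandedTerm m)
  summand-expansion m = begin
    (A * Σ n b) * Δ                ≈⟨ *-cong (*-distribˡ-Σ n A b) refl ⟩
    Σ n (λ j → A * b j) * Δ        ≈⟨ *-distribʳ-Σ n Δ _ ⟩
    Σ n (λ j → (A * b j) * Δ)      ≈⟨ Σ-cong n term ⟩
    Σ n (expandedTerm m)           ∎
    where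
    n = l ∸ m
    A = qfactOverFact q m * qbinom q l m
    b = λ j → qbinom q n j * qfactOverFact q j * qpow1m q x (n ∸ j) * φ (bernK k j)
    Δ = φ (Δ0 k m / 1)
    term : ∀ j → (A * b j) * Δ ≈ expandedTerm m j
    term j = begin
      (A * b j) * Δ
        ≈⟨ solve 9 (λ fm im bl bn fj ij y B d →
                      fm :* im :* bl :* (bn :* (fj :* ij) :* y :* B) :* d
                      := bl :* fm :* (bn :* fj) :* y :* (d :* im :* (B :* ij)))
                 refl (qfact q m) (φ (invFact m)) (qbinom q l m) (qbinom q n j) (qfact q j)
                      (φ (invFact j)) (qpow1m q x (n ∸ j)) (φ (bernK k j)) Δ ⟩
      (qbinom q l m * qfact q m) * (qbinom q n j * qfact q j) * qpow1m q x (n ∸ j)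
        * (Δ * φ (invFact m) * (φ (bernK k j) * φ (invFact j)))
        ≈⟨ *-cong (*-cong (*-cong (qbinom*qfact≈qfalling l m) (qbinom*qfact≈qfalling n j)) refl)
                  (sym (trans (*-homo _ _) (*-cong (*-homo _ _) (*-homo _ _)))) ⟩
      qfalling l m * qfalling n j * qpow1m q x (n ∸ j) * φ (EGF.egfΔ0 k m ℚ.* EGF.egfBernoulli k j)
        ≈⟨ *-cong (*-cong (qfalling-+ l m j) (reflexive (≡.cong (qpow1m q x) (ℕP.∸-+-assoc l m j)))) refl ⟩
      expandedTerm m j ∎

  Σ-antidiagonal : ∀ s → s ≤ l →
    Σ s (λ m → expandedTerm m (s ∸ m)) ≈ qfalling l s * qpow1m q x (l ∸ s) * δ k s
  Σ-antidiagonal s s≤l = begin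
    Σ s (λ m → expandedTerm m (s ∸ m))
      ≈⟨ Σ-cong≤ s (λ m m≤s → *-cong (reflexive (≡.cong (λ t → qfalling l t * qpow1m q x (l ∸ t))
                                                         (ℕP.m+[n∸m]≡n m≤s))) refl) ⟩
    Σ s (λ m → F * φ (EGF.egfΔ0 k m ℚ.* EGF.egfBernoulli k (s ∸ m)))
      ≈⟨ *-distribˡ-Σ s F _ ⟨
    F * Σ s (λ m → φ (EGF.egfΔ0 k m ℚ.* EGF.egfBernoulli k (s ∸ m)))
      ≈⟨ *-cong refl (φ-Σ s _) ⟨
    F * φ ((EGF.egfΔ0 k EGF.⋆ EGF.egfBernoulli k) s)
      ≈⟨ *-cong refl (trans (reflexive (≡.cong φ (EGF.egfΔ0⋆egfBernoulli k s))) (φ-δ k s)) ⟩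
    F * δ k s ∎
    where F = qfalling l s * qpow1m q x (l ∸ s)

  Σ-summand : Σ l summand ≈ Σ l (λ s → qfalling l s * qpow1m q x (l ∸ s) * δ k s)
  Σ-summand = begin
    Σ l summand                                       ≈⟨ Σ-cong l summand-expansion ⟩
    Σ l (λ m → Σ (l ∸ m) (expandedTerm m))            ≈⟨ Σ-triangle l expandedTerm ⟩
    Σ l (λ s → Σ s (λ m → expandedTerm m (s ∸ m)))    ≈⟨ Σ-cong≤ l Σ-antidiagonal ⟩
    Σ l (λ s → qfalling l s * qpow1m q x (l ∸ s) * δ k s) ∎

  expansion-collapses : k ≤ l → (inv : Carrier) → inv * qfact q k ≈ 1# →
    (pow x k * inv) * Σ l summand ≈ qbinom q l k * pow x k * qpow1m q x (l ∸ k)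
  expansion-collapses k≤l inv inv*[k]!≈1 = begin
    (pow x k * inv) * Σ l summand
      ≈⟨ *-cong refl (trans Σ-summand (Σ-δ l k _ k≤l)) ⟩
    (pow x k * inv) * (qfalling l k * qpow1m q x (l ∸ k))
      ≈⟨ *-cong refl (*-cong (qbinom*qfact≈qfalling l k) refl) ⟨
    (pow x k * inv) * (qbinom q l k * qfact q k * qpow1m q x (l ∸ k))
      ≈⟨ solve 5 (λ p i b f y → p :* i :* (b :* f :* y) := b :* p :* y :* (i :* f))
               refl (pow x k) inv (qbinom q l k) (qfact q k) (qpow1m q x (l ∸ k)) ⟩
    qbinom q l k * pow x k * qpow1m q x (l ∸ k) * (inv * qfact q k)
      ≈⟨ *-cong refl inv*[k]!≈1 ⟩
    qbinom q l k * pow x k * qpow1m q x (l ∸ k) * 1#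
      ≈⟨ *-identityʳ _ ⟩
    qbinom q l k * pow x k * qpow1m q x (l ∸ k) ∎

  expansion-vanishes : l < k → (inv : Carrier) → (pow x k * inv) * Σ l summand ≈ 0#
  expansion-vanishes l<k inv = trans (*-cong refl (trans Σ-summand (Σ-δ-out l k _ l<k))) (zeroʳ _)

corollary11 : ∀ {c ℓ} (R : CommutativeRing c ℓ) (φ : ℚ → CommutativeRing.Carrier R)
    → RingMorphisms.IsRingHomomorphism +-*-rawRing (CommutativeRing.rawRing R) φ
    → (q x : CommutativeRing.Carrier R) (k l : ℕ)
    → (inv : CommutativeRing.Carrier R)
    → CommutativeRing._≈_ R (CommutativeRing._*_ R inv (QDefs.qfact R φ q k)) (CommutativeRing.1# R)
    → CommutativeRing._≈_ R
        (QDefs.Bkn R φ q x k l)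
        (CommutativeRing._*_ R
          (CommutativeRing._*_ R (QDefs.pow R φ x k) inv)
          (QDefs.Σ R φ l (λ m →
            CommutativeRing._*_ R
              (CommutativeRing._*_ R
                (CommutativeRing._*_ R (QDefs.qfactOverFact R φ q m) (QDefs.qbinom R φ q l m))
                (QDefs.beta R φ q x k (l ∸ m)))
              (φ (Δ0 k m / 1)))))
corollary11 R φ φ-hom q x k l inv inv*[k]!≈1 with k ≤? l
... | yes k≤l = CommutativeRing.sym R (expansion-collapses k≤l inv inv*[k]!≈1)
  where open BernsteinExpansion R φ φ-hom q x k l
... | no  k≰l = CommutativeRing.sym R (expansion-vanishes (ℕP.≰⇒> k≰l) inv)
  where open BernsteinExpansion R φ φ-hom q x k l
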